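{- Let $k\ge1$. The map that assigns to each Dyck nest $H$ of length $2k$ its clone $\sigma(H)=(\sigma_{k-1}(H),\ldots,\sigma_1(H))$ is a bijection from the set of Dyck nests of length $2k$ onto the set of their clones; that is, distinct Dyck nests of length $2k$ have distinct clones.
   Context: A Dyck word of length $2k$ is a binary string with $k$ ones in which every prefix has at least as many 0s as 1s. Reading it left to right, 0 = up-step and 1 = down-step gives a lattice path from height 0. Its Dyck nest is the integer string of length $2k$ obtained by labelling the steps with $1,2,\ldots,k$: process the horizontal unit layers $[y,y+1]$, $y=0,1,2,\ldots$, in increasing order, and in each layer assign consecutive integers (continuing the count from earlier layers) to the up-steps from right to left and likewise to the down-steps from right to left. Each value in $[1,k]$ occurs exactly twice. For a Dyck nest $H$ and $j\in[1,k-1]$, let $p_j<r_j$ be the two positions of $H$ holding the value $j$, and let $\sigma_j(H)=\lfloor (r_j-p_j)/2\rfloor$; the clone of $H$ is the vector $\sigma(H)=(\sigma_{k-1}(H),\ldots,\sigma_1(H))$. (In the paper the Dyck nests of length $2k$ are enumerated as the "$k$-blown" nests $F^k(n)$, $0\le n<\frac{(2k)!}{k!(k+1)!}$, each Dyck nest of length $2k$ occurring exactly once.) -}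

module Defs where

open import Data.Bool using (Bool; true; false; not; _∧_; if_then_else_)
open import Data.Nat using (ℕ; zero; suc; _+_; _*_; _∸_; _≤_; _<ᵇ_; _≡ᵇ_; ⌊_/2⌋)
open import Data.List using (List; []; _∷_; length; take; map; downFrom)
open import Data.Product using (_×_; _,_)
open import Relation.Binary.PropositionalEquality using (_≡_)

-- Steps: false = 0 = up-step, true = 1 = down-step.

ones : List Bool → ℕ
ones [] = 0
ones (true ∷ w) = suc (ones w)
ones (false ∷ w) = ones w

zeros : List Bool → ℕ
zeros [] = 0
zeros (true ∷ w) = zeros w
zeros (false ∷ w) = suc (zeros w)

IsDyckWord : ℕ → List Bool → Set
IsDyckWord k w =
  (length w ≡ 2 * k) × (ones w ≡ k) × (∀ n → ones (take n w) ≤ zeros (take n w))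

-- For each step: (is it a down-step?, the layer y such that the step lies in [y, y+1]).
-- An up-step starting at height h lies in layer h; a down-step starting at height h
-- lies in layer h - 1.
stepsFrom : ℕ → List Bool → List (Bool × ℕ)
stepsFrom h [] = []
stepsFrom h (false ∷ w) = (false , h) ∷ stepsFrom (suc h) w
stepsFrom h (true ∷ w) = (true , h ∸ 1) ∷ stepsFrom (h ∸ 1) w

steps : List Bool → List (Bool × ℕ)
steps = stepsFrom 0

boolEq : Bool → Bool → Bool
boolEq true true = true
boolEq false false = true
boolEq _ _ = false

-- number of up-steps lying in layers strictly below y (= total labels used by earlier layers)
countLower : List (Bool × ℕ) → ℕ → ℕ
countLower [] y = 0
countLower ((d , y') ∷ s) y =
  (if not d ∧ (y' <ᵇ y) then 1 else 0) + countLower s y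

countSame : List (Bool × ℕ) → Bool → ℕ → ℕ
countSame [] d y = 0
countSame ((d' , y') ∷ s) d y =
  (if boolEq d d' ∧ (y' ≡ᵇ y) then 1 else 0) + countSame s d y

-- label of a step = (labels used by lower layers) + (same-type steps of the same layer
-- to its right) + 1  : i.e. consecutive labelling, layer by layer, right to left.
labels : List (Bool × ℕ) → List (Bool × ℕ) → List ℕ
labels all [] = []
labels all ((d , y) ∷ rest) = suc (countLower all y + countSame rest d y) ∷ labels all rest

nest : List Bool → List ℕ
nest w = labels (steps w) (steps w)

positionsFrom : ℕ → ℕ → List ℕ → List ℕ
positionsFrom i j [] = []
positionsFrom i j (x ∷ H) =
  if x ≡ᵇ j then i ∷ positionsFrom (suc i) j H else positionsFrom (suc i) j H

positions : ℕ → List ℕ → List ℕ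
positions = positionsFrom 0

-- σ_j(H) = ⌊(r_j − p_j)/2⌋ where p_j < r_j are the two positions holding j
-- (in a Dyck nest every value in [1,k] occurs exactly twice; default 0 otherwise)
σ : ℕ → List ℕ → ℕ
σ j H with positions j H
... | p ∷ r ∷ _ = ⌊ r ∸ p /2⌋
... | _ = 0

clone : ℕ → List ℕ → List ℕ
clone k H = map (λ i → σ (suc i) H) (downFrom (k ∸ 1))

{-# OPTIONS --safe #-}
-- View a Dyck path as a sequence of M arches ↑ a₁ ↓ … ↑ a_M ↓. In its Dyck nest the two
-- steps of the i-th arch from the right both carry the label i, and every other step carries
-- M plus its label in the Dyck nest of the interior a₁ ⋯ a_M. Since the steps of an arch of
-- size s enclose 2s interior steps, σ_i is the size of the arch labelled i for i ≤ M. A value of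
-- the interior's nest occurs only inside one aᵢ, so inserting the arch labels does not change
-- the gap between its two occurrences, and σ_{M+j} equals σ_j of the interior. The clone thus
-- determines the arch sizes (the last one from the total size) and the clone of the interior,
-- and induction on the size gives the nest.
module Submission where

open import Defs
open import Data.Bool using (Bool; true; false; not; if_then_else_; T)
open import Data.Bool.Properties using (∧-zeroʳ)
open import Data.Nat using (ℕ; zero; suc; _+_; _*_; _∸_; _⊓_; _≤_; _<_; z≤n; s≤s; s≤s⁻¹; _<ᵇ_; _≡ᵇ_; ⌊_/2⌋)
open import Data.Nat.Properties
open import Data.Nat.Tactic.RingSolver using (solve-∀)
open import Algebra.Properties.CommutativeSemigroup +-commutativeSemigroup using (x∙yz≈y∙xz)
open import Data.Nat.ListAction using (sum)
open import Data.Nat.ListAction.Properties using (sum-↭)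
open import Data.List using (List; []; _∷_; length; take; drop; map; downFrom; _++_; reverse; _∷ʳ_)
open import Data.List.Properties
open import Data.Vec using (Vec; []; _∷_)
open import Data.Product using (Σ; ∃; _×_; _,_; proj₁; proj₂)
import Data.Product as Product
open import Data.Sum using (_⊎_; inj₁; inj₂)
open import Relation.Binary.PropositionalEquality
open import Relation.Nullary using (Dec; ¬_; contradiction; yes; no)
open import Data.Empty using (⊥)
open import Data.Unit using (⊤; tt)
open import Function using (_∘_)
open import Data.List.Membership.Propositional using (_∈_; _∉_)
open import Data.List.Relation.Unary.Any using (here; there)
open import Data.List.Relation.Unary.All using (All; []; _∷_)
import Data.List.Relation.Unary.All as All
import Data.List.Relation.Unary.All.Properties as All
open import Data.List.Membership.Propositional.Properties using (∈-map⁻; ∈-++⁻; ∈-downFrom⁺)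
import Data.List.Relation.Binary.Sublist.Propositional as Sublist
open import Data.List.Relation.Binary.Permutation.Propositional.Properties using (↭-reverse)
open import Data.List.Membership.DecPropositional _≟_ using (_∈?_)
open import Data.List.Relation.Binary.Sublist.Propositional.Properties using (take-⊆; drop-⊆; take⁺)


double-arch : ∀ m n → suc (2 * m + suc (2 * n)) ≡ 2 * suc (m + n)
double-arch = solve-∀

⌊1+2n/2⌋≡n : ∀ n → ⌊ suc (2 * n) /2⌋ ≡ n
⌊1+2n/2⌋≡n zero = refl
⌊1+2n/2⌋≡n (suc n) rewrite +-suc n (n + 0) = cong suc (⌊1+2n/2⌋≡n n)

⌊[1+i+2n]∸i/2⌋≡n : ∀ i n → ⌊ suc (i + 2 * n) ∸ i /2⌋ ≡ n
⌊[1+i+2n]∸i/2⌋≡n i n = trans (cong ⌊_/2⌋ (trans (cong (_∸ i) (sym (+-suc i (2 * n)))) (m+n∸m≡n i (suc (2 * n))))) (⌊1+2n/2⌋≡n n)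

≢⇒≡ᵇ≡false : ∀ {m n} → m ≢ n → (m ≡ᵇ n) ≡ false
≢⇒≡ᵇ≡false {m} {n} m≢n with m ≡ᵇ n in eq
... | true = contradiction (≡ᵇ⇒≡ m n (subst T (sym eq) _)) m≢n
... | false = refl

+-cancelˡ-≡ᵇ : ∀ M x y → (M + x ≡ᵇ M + y) ≡ (x ≡ᵇ y)
+-cancelˡ-≡ᵇ zero x y = refl
+-cancelˡ-≡ᵇ (suc M) x y = +-cancelˡ-≡ᵇ M x y

length-take-drop : ∀ {A : Set} m n (N : List A) → length N ≡ m + n → length (take m N) ≡ m × length (drop m N) ≡ n
length-take-drop m n N len =
  trans (length-take m N) (trans (cong (m ⊓_) len) (m≤n⇒m⊓n≡m (m≤m+n m n))) ,
  trans (length-drop m N) (trans (cong (_∸ m) len) (m+n∸m≡n m n))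

length-take-drop-≤ : ∀ {A : Set} m n (N : List A) → m + n ≤ length N → length (take m N) ≡ m × n ≤ length (drop m N)
length-take-drop-≤ m n N le =
  trans (length-take m N) (m≤n⇒m⊓n≡m (≤-trans (m≤m+n m n) le)) ,
  subst (n ≤_) (sym (length-drop m N)) (m+n≤o⇒m≤o∸n n (subst (_≤ length N) (+-comm m n) le))

length-take-drop-double : ∀ {A : Set} m n (N : List A) → length N ≡ 2 * (m + n) →
  length (take (2 * m) N) ≡ 2 * m × length (drop (2 * m) N) ≡ 2 * n
length-take-drop-double m n N len = length-take-drop (2 * m) (2 * n) N (trans len (*-distribˡ-+ 2 m n))

take-drop-length-++ : ∀ {A : Set} (xs ys : List A) → take (length xs) (xs ++ ys) ≡ xs × drop (length xs) (xs ++ ys) ≡ ys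
take-drop-length-++ [] ys = refl , refl
take-drop-length-++ (x ∷ xs) ys = Product.map₁ (cong (x ∷_)) (take-drop-length-++ xs ys)

take-drop-≡++ : ∀ {A : Set} {H xs ys : List A} {m} → H ≡ xs ++ ys → length xs ≡ m → take m H ≡ xs × drop m H ≡ ys
take-drop-≡++ {xs = xs} {ys} refl refl = take-drop-length-++ xs ys

∈-take-drop : ∀ {A : Set} m n (xs : List A) {v} → v ∈ take m (drop n xs) → v ∈ take (n + m) xs
∈-take-drop m n xs {v} v∈ = Sublist.lookup (drop-⊆ n (take (n + m) xs)) (subst (v ∈_) (take-drop m n xs) v∈)

length-∷ʳ : ∀ (xs : List ℕ) x → length (xs ∷ʳ x) ≡ suc (length xs)
length-∷ʳ xs x = trans (length-++ xs) (+-comm (length xs) 1)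

map-≡⇒≡ : ∀ {A B : Set} (f g : A → B) xs {x} → map f xs ≡ map g xs → x ∈ xs → f x ≡ g x
map-≡⇒≡ f g (y ∷ ys) e (here refl) = ∷-injectiveˡ e
map-≡⇒≡ f g (y ∷ ys) e (there x∈) = map-≡⇒≡ f g ys (∷-injectiveʳ e) x∈


-- Dyck paths as sequences of arches

infixr 5 ↑_↓_
infixr 5 _⊕_

data Dyck : Set where
  ε : Dyck
  ↑_↓_ : Dyck → Dyck → Dyck

word : Dyck → List Bool
word ε = []
word (↑ a ↓ b) = false ∷ word a ++ true ∷ word b

size : Dyck → ℕ
size ε = 0
size (↑ a ↓ b) = suc (size a + size b)

_⊕_ : Dyck → Dyck → Dyck
ε ⊕ c = c
(↑ a ↓ b) ⊕ c = ↑ a ↓ (b ⊕ c)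

interior : Dyck → Dyck
interior ε = ε
interior (↑ a ↓ b) = a ⊕ interior b

archSizes : Dyck → List ℕ
archSizes ε = []
archSizes (↑ a ↓ b) = size a ∷ archSizes b

arches : Dyck → ℕ
arches f = length (archSizes f)

word-⊕ : ∀ a c → word (a ⊕ c) ≡ word a ++ word c
word-⊕ ε c = refl
word-⊕ (↑ a ↓ b) c = cong (false ∷_) (begin
  word a ++ true ∷ word (b ⊕ c)     ≡⟨ cong (λ u → word a ++ true ∷ u) (word-⊕ b c) ⟩
  word a ++ true ∷ word b ++ word c ≡⟨ ++-assoc (word a) (true ∷ word b) (word c) ⟨
  (word a ++ true ∷ word b) ++ word c ∎)
  where open ≡-Reasoning

size-⊕ : ∀ a c → size (a ⊕ c) ≡ size a + size c
size-⊕ ε c = refl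
size-⊕ (↑ a ↓ b) c = cong suc (trans (cong (size a +_) (size-⊕ b c)) (sym (+-assoc (size a) (size b) (size c))))

⊕-assoc : ∀ a b c → (a ⊕ b) ⊕ c ≡ a ⊕ (b ⊕ c)
⊕-assoc ε b c = refl
⊕-assoc (↑ x ↓ y) b c = cong (↑ x ↓_) (⊕-assoc y b c)

archSizes-⊕ : ∀ a b → archSizes (a ⊕ b) ≡ archSizes a ++ archSizes b
archSizes-⊕ ε b = refl
archSizes-⊕ (↑ x ↓ y) b = cong (size x ∷_) (archSizes-⊕ y b)

arches-⊕ : ∀ a b → arches (a ⊕ b) ≡ arches a + arches b
arches-⊕ a b = trans (cong length (archSizes-⊕ a b)) (length-++ (archSizes a))

interior-⊕ : ∀ a b → interior (a ⊕ b) ≡ interior a ⊕ interior b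
interior-⊕ ε b = refl
interior-⊕ (↑ x ↓ y) b = trans (cong (x ⊕_) (interior-⊕ y b)) (sym (⊕-assoc x (interior y) (interior b)))

sum-archSizes : ∀ f → sum (archSizes f) ≡ size (interior f)
sum-archSizes ε = refl
sum-archSizes (↑ a ↓ b) = trans (cong (size a +_) (sum-archSizes b)) (sym (size-⊕ a (interior b)))

size≡arches+size-interior : ∀ f → size f ≡ arches f + size (interior f)
size≡arches+size-interior ε = refl
size≡arches+size-interior (↑ a ↓ b) = cong suc (begin
  size a + size b                                ≡⟨ cong (size a +_) (size≡arches+size-interior b) ⟩
  size a + (arches b + size (interior b))        ≡⟨ x∙yz≈y∙xz (size a) (arches b) (size (interior b)) ⟩
  arches b + (size a + size (interior b))        ≡⟨ cong (arches b +_) (size-⊕ a (interior b)) ⟨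
  arches b + size (a ⊕ interior b)               ∎)
  where open ≡-Reasoning

size-interior< : ∀ a b → size (interior (↑ a ↓ b)) < size (↑ a ↓ b)
size-interior< a b = s≤s (≤-trans (m≤n+m _ (arches b)) (≤-reflexive (sym (suc-injective (size≡arches+size-interior (↑ a ↓ b))))))

size≡sum-suc-archSizes : ∀ f → size f ≡ sum (map suc (archSizes f))
size≡sum-suc-archSizes ε = refl
size≡sum-suc-archSizes (↑ a ↓ b) = cong (λ n → suc (size a + n)) (size≡sum-suc-archSizes b)

length-word : ∀ f → length (word f) ≡ 2 * size f
length-word ε = refl
length-word (↑ a ↓ b) = begin
  suc (length (word a ++ true ∷ word b))        ≡⟨ cong suc (length-++ (word a)) ⟩
  suc (length (word a) + suc (length (word b))) ≡⟨ cong₂ (λ u v → suc (u + suc v)) (length-word a) (length-word b) ⟩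
  suc (2 * size a + suc (2 * size b))           ≡⟨ double-arch (size a) (size b) ⟩
  2 * suc (size a + size b)                     ∎
  where open ≡-Reasoning


-- Parsing Dyck words

data Descent : ℕ → List Bool → Set where
  end  : Descent 0 []
  up   : ∀ {h w} → Descent (suc h) w → Descent h (false ∷ w)
  down : ∀ {h w} → Descent h w → Descent (suc h) (true ∷ w)

descent : ∀ h w → (∀ n → ones (take n w) ≤ h + zeros (take n w)) → ones w ≡ h + zeros w → Descent h w
descent h [] _ balanced rewrite +-identityʳ h | sym balanced = end
descent h (false ∷ w) bounded balanced = up (descent (suc h) w bounded′ (trans balanced (+-suc h (zeros w))))
  where
  bounded′ : ∀ n → ones (take n w) ≤ suc h + zeros (take n w)
  bounded′ n = subst (ones (take n w) ≤_) (+-suc h _) (bounded (suc n))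
descent zero (true ∷ w) bounded _ with () ← bounded 1
descent (suc h) (true ∷ w) bounded balanced = down (descent h w (λ n → s≤s⁻¹ (bounded (suc n))) (suc-injective balanced))

closings : ∀ {h} → Vec Dyck h → List Bool
closings [] = []
closings (g ∷ gs) = true ∷ word g ++ closings gs

decompose : ∀ {h w} → Descent h w → Σ Dyck λ f → Σ (Vec Dyck h) λ gs → w ≡ word f ++ closings gs
decompose end = ε , [] , refl
decompose (down d) with f , gs , e ← decompose d = ε , f ∷ gs , cong (true ∷_) e
decompose (up d) with f , g ∷ gs , e ← decompose d =
  ↑ f ↓ g , gs , cong (false ∷_) (trans e (sym (++-assoc (word f) (true ∷ word g) (closings gs))))

length≡ones+zeros : ∀ w → length w ≡ ones w + zeros w
length≡ones+zeros [] = refl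
length≡ones+zeros (true ∷ w) = cong suc (length≡ones+zeros w)
length≡ones+zeros (false ∷ w) = trans (cong suc (length≡ones+zeros w)) (sym (+-suc (ones w) (zeros w)))

dyckWord⇒word : ∀ k w → IsDyckWord k w → Σ Dyck λ f → word f ≡ w × size f ≡ k
dyckWord⇒word k w (len , ones≡k , prefixes) with decompose (descent 0 w prefixes ones≡zeros)
  where
  ones≡zeros : ones w ≡ zeros w
  ones≡zeros = trans ones≡k (+-cancelˡ-≡ k k (zeros w) (begin
    k + k              ≡⟨ cong (k +_) (+-identityʳ k) ⟨
    2 * k              ≡⟨ len ⟨
    length w           ≡⟨ length≡ones+zeros w ⟩
    ones w + zeros w   ≡⟨ cong (_+ zeros w) ones≡k ⟩
    k + zeros w        ∎))
    where open ≡-Reasoning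
... | f , [] , e = f , sym w≡f , *-cancelˡ-≡ (size f) k 2 (trans (sym (length-word f)) (trans (cong length (sym w≡f)) len))
  where
  w≡f : w ≡ word f
  w≡f = trans e (++-identityʳ (word f))


-- Steps and layers

raise : ℕ → Bool × ℕ → Bool × ℕ
raise h (d , y) = d , h + y

map-raise-raise : ∀ h (L : List (Bool × ℕ)) → map (raise h) (map (raise 1) L) ≡ map (raise (suc h)) L
map-raise-raise h [] = refl
map-raise-raise h ((d , y) ∷ L) = cong₂ _∷_ (cong (d ,_) (+-suc h y)) (map-raise-raise h L)

map-raise-arch : ∀ h A B R →
  map (raise h) ((false , 0) ∷ map (raise 1) A ++ (true , 0) ∷ B) ++ R
    ≡ (false , h) ∷ map (raise (suc h)) A ++ (true , h) ∷ map (raise h) B ++ R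
map-raise-arch h A B R
  rewrite +-identityʳ h
        | map-++ (raise h) (map (raise 1) A) ((true , 0) ∷ B)
        | map-raise-raise h A
        | +-identityʳ h
        | ++-assoc (map (raise (suc h)) A) ((true , h) ∷ map (raise h) B) R
        = refl

stepsFrom-word : ∀ f h r → stepsFrom h (word f ++ r) ≡ map (raise h) (steps (word f)) ++ stepsFrom h r
stepsFrom-word ε h r = refl
stepsFrom-word (↑ a ↓ b) h r = begin
  stepsFrom h (false ∷ (word a ++ true ∷ word b) ++ r)
    ≡⟨ cong (λ u → stepsFrom h (false ∷ u)) (++-assoc (word a) (true ∷ word b) r) ⟩
  (false , h) ∷ stepsFrom (suc h) (word a ++ true ∷ word b ++ r)
    ≡⟨ cong ((false , h) ∷_) (stepsFrom-word a (suc h) (true ∷ word b ++ r)) ⟩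
  (false , h) ∷ map (raise (suc h)) (steps (word a)) ++ (true , h) ∷ stepsFrom h (word b ++ r)
    ≡⟨ cong (λ u → (false , h) ∷ map (raise (suc h)) (steps (word a)) ++ (true , h) ∷ u) (stepsFrom-word b h r) ⟩
  (false , h) ∷ map (raise (suc h)) (steps (word a)) ++ (true , h) ∷ map (raise h) (steps (word b)) ++ stepsFrom h r
    ≡⟨ map-raise-arch h (steps (word a)) (steps (word b)) (stepsFrom h r) ⟨
  map (raise h) ((false , 0) ∷ map (raise 1) (steps (word a)) ++ (true , 0) ∷ steps (word b)) ++ stepsFrom h r
    ≡⟨ cong (λ u → map (raise h) ((false , 0) ∷ u) ++ stepsFrom h r) (stepsFrom-word a 1 (true ∷ word b)) ⟨
  map (raise h) (steps (word (↑ a ↓ b))) ++ stepsFrom h r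
    ∎
  where open ≡-Reasoning

steps-↑↓ : ∀ a b → steps (word (↑ a ↓ b)) ≡ (false , 0) ∷ map (raise 1) (steps (word a)) ++ (true , 0) ∷ steps (word b)
steps-↑↓ a b = cong ((false , 0) ∷_) (stepsFrom-word a 1 (true ∷ word b))

steps-⊕ : ∀ a c → steps (word (a ⊕ c)) ≡ steps (word a) ++ steps (word c)
steps-⊕ a c = begin
  steps (word (a ⊕ c))                          ≡⟨ cong steps (word-⊕ a c) ⟩
  stepsFrom 0 (word a ++ word c)                ≡⟨ stepsFrom-word a 0 (word c) ⟩
  map (raise 0) (steps (word a)) ++ steps (word c) ≡⟨ cong (_++ steps (word c)) (map-id (steps (word a))) ⟩
  steps (word a) ++ steps (word c)              ∎
  where open ≡-Reasoning

length-stepsFrom : ∀ h w → length (stepsFrom h w) ≡ length w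
length-stepsFrom h [] = refl
length-stepsFrom h (false ∷ w) = cong suc (length-stepsFrom (suc h) w)
length-stepsFrom h (true ∷ w) = cong suc (length-stepsFrom (h ∸ 1) w)

length-steps : ∀ f → length (steps (word f)) ≡ 2 * size f
length-steps f = trans (length-stepsFrom 0 (word f)) (length-word f)

upper : List (Bool × ℕ) → List (Bool × ℕ)
upper [] = []
upper ((d , zero) ∷ s) = upper s
upper ((d , suc y) ∷ s) = (d , y) ∷ upper s

upper-raise : ∀ L T → upper (map (raise 1) L ++ T) ≡ L ++ upper T
upper-raise [] T = refl
upper-raise ((d , y) ∷ L) T = cong ((d , y) ∷_) (upper-raise L T)

upper-steps : ∀ f → upper (steps (word f)) ≡ steps (word (interior f))
upper-steps ε = refl
upper-steps (↑ a ↓ b) = begin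
  upper (steps (word (↑ a ↓ b)))                      ≡⟨ cong upper (steps-↑↓ a b) ⟩
  upper (map (raise 1) (steps (word a)) ++ (true , 0) ∷ steps (word b))
                                                      ≡⟨ upper-raise (steps (word a)) _ ⟩
  steps (word a) ++ upper (steps (word b))            ≡⟨ cong (steps (word a) ++_) (upper-steps b) ⟩
  steps (word a) ++ steps (word (interior b))         ≡⟨ steps-⊕ a (interior b) ⟨
  steps (word (a ⊕ interior b))                       ∎
  where open ≡-Reasoning

countSame-raise : ∀ L T d → countSame (map (raise 1) L ++ T) d 0 ≡ countSame T d 0
countSame-raise [] T d = refl
countSame-raise ((d′ , y) ∷ L) T d rewrite ∧-zeroʳ (boolEq d d′) = countSame-raise L T d

countSame-bottom-steps : ∀ f d → countSame (steps (word f)) d 0 ≡ arches f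
countSame-bottom-steps ε d = refl
countSame-bottom-steps (↑ a ↓ b) d = trans (cong (λ S → countSame S d 0) (steps-↑↓ a b)) (bottom d)
  where
  bottom : ∀ d → countSame ((false , 0) ∷ map (raise 1) (steps (word a)) ++ (true , 0) ∷ steps (word b)) d 0 ≡ suc (arches b)
  bottom false = cong suc (trans (countSame-raise (steps (word a)) _ false) (countSame-bottom-steps b false))
  bottom true = trans (countSame-raise (steps (word a)) _ true) (cong suc (countSame-bottom-steps b true))

countSame-upper : ∀ S d y → countSame S d (suc y) ≡ countSame (upper S) d y
countSame-upper [] d y = refl
countSame-upper ((d′ , zero) ∷ S) d y rewrite ∧-zeroʳ (boolEq d d′) = countSame-upper S d y
countSame-upper ((d′ , suc y′) ∷ S) d y = cong (_ +_) (countSame-upper S d y)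

countLower-zero : ∀ S → countLower S 0 ≡ 0
countLower-zero [] = refl
countLower-zero ((d , y) ∷ S) rewrite ∧-zeroʳ (not d) = countLower-zero S

-- countSame S false 0 counts the up-steps of layer 0.
countLower-suc : ∀ S y → countLower S (suc y) ≡ countSame S false 0 + countLower (upper S) y
countLower-suc [] y = refl
countLower-suc ((true , zero) ∷ S) y = countLower-suc S y
countLower-suc ((false , zero) ∷ S) y = cong suc (countLower-suc S y)
countLower-suc ((true , suc y′) ∷ S) y = countLower-suc S y
countLower-suc ((false , suc y′) ∷ S) y =
  trans (cong (_ +_) (countLower-suc S y)) (x∙yz≈y∙xz (if y′ <ᵇ y then 1 else 0) (countSame S false 0) (countLower (upper S) y))


-- The Dyck nest, layer 0 first

dyckNest : Dyck → List ℕ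
dyckNest f = nest (word f)

labelWith : (ℕ → ℕ) → List (Bool × ℕ) → List ℕ
labelWith base [] = []
labelWith base ((d , y) ∷ s) = suc (base y + countSame s d y) ∷ labelWith base s

labels≡labelWith : ∀ all s → labels all s ≡ labelWith (countLower all) s
labels≡labelWith all [] = refl
labels≡labelWith all ((d , y) ∷ s) = cong (suc (countLower all y + countSame s d y) ∷_) (labels≡labelWith all s)

graft : ℕ → List (Bool × ℕ) → List ℕ → List ℕ
graft M [] N = []
graft M ((d , zero) ∷ s) N = suc (countSame s d 0) ∷ graft M s N
graft M ((d , suc y) ∷ s) [] = []
graft M ((d , suc y) ∷ s) (x ∷ N) = M + x ∷ graft M s N

labelWith≡graft : ∀ base base′ M → base 0 ≡ 0 → (∀ y → base (suc y) ≡ M + base′ y) →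
  ∀ S → labelWith base S ≡ graft M S (labelWith base′ (upper S))
labelWith≡graft base base′ M base0 baseSuc [] = refl
labelWith≡graft base base′ M base0 baseSuc ((d , zero) ∷ S) =
  cong₂ _∷_ (cong (λ n → suc (n + countSame S d 0)) base0) (labelWith≡graft base base′ M base0 baseSuc S)
labelWith≡graft base base′ M base0 baseSuc ((d , suc y) ∷ S) = cong₂ _∷_ top (labelWith≡graft base base′ M base0 baseSuc S)
  where
  open ≡-Reasoning
  top : suc (base (suc y) + countSame S d (suc y)) ≡ M + suc (base′ y + countSame (upper S) d y)
  top = begin
    suc (base (suc y) + countSame S d (suc y))       ≡⟨ cong₂ (λ m n → suc (m + n)) (baseSuc y) (countSame-upper S d y) ⟩
    suc (M + base′ y + countSame (upper S) d y)      ≡⟨ cong suc (+-assoc M (base′ y) _) ⟩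
    suc (M + (base′ y + countSame (upper S) d y))    ≡⟨ +-suc M _ ⟨
    M + suc (base′ y + countSame (upper S) d y)      ∎

dyckNest≡graft : ∀ f → dyckNest f ≡ graft (arches f) (steps (word f)) (dyckNest (interior f))
dyckNest≡graft f = begin
  labels S S                                            ≡⟨ labels≡labelWith S S ⟩
  labelWith (countLower S) S                            ≡⟨ labelWith≡graft (countLower S) (countLower S′) (arches f) (countLower-zero S) lowerSuc S ⟩
  graft (arches f) S (labelWith (countLower S′) (upper S)) ≡⟨ cong (λ U → graft (arches f) S (labelWith (countLower S′) U)) (upper-steps f) ⟩
  graft (arches f) S (labelWith (countLower S′) S′)     ≡⟨ cong (graft (arches f) S) (labels≡labelWith S′ S′) ⟨
  graft (arches f) S (labels S′ S′)                     ∎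
  where
  open ≡-Reasoning
  S = steps (word f)
  S′ = steps (word (interior f))
  lowerSuc : ∀ y → countLower S (suc y) ≡ arches f + countLower S′ y
  lowerSuc y = trans (countLower-suc S y) (cong₂ (λ m U → m + countLower U y) (countSame-bottom-steps f false) (upper-steps f))

-- The Dyck nest of a path with M arches of sizes ss, built from the Dyck nest N of its
-- interior; the arches themselves are labelled l + 1, l + 2, … from right to left.
assemble : ℕ → ℕ → List ℕ → List ℕ → List ℕ
assemble M l [] N = []
assemble M l (s ∷ ss) N =
  suc (l + length ss) ∷ map (M +_) (take (2 * s) N) ++ suc (l + length ss) ∷ assemble M l ss (drop (2 * s) N)

graft-raise : ∀ M L T N → length L ≤ length N →
  graft M (map (raise 1) L ++ T) N ≡ map (M +_) (take (length L) N) ++ graft M T (drop (length L) N)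
graft-raise M [] T N _ = refl
graft-raise M ((d , y) ∷ L) T (x ∷ N) (s≤s len) = cong (M + x ∷_) (graft-raise M L T N len)

graft≡assemble : ∀ M f N → length N ≡ 2 * sum (archSizes f) → graft M (steps (word f)) N ≡ assemble M 0 (archSizes f) N
graft≡assemble M ε N _ = refl
graft≡assemble M (↑ a ↓ b) N len = begin
  graft M (steps (word (↑ a ↓ b))) N
    ≡⟨ cong (λ S → graft M S N) (steps-↑↓ a b) ⟩
  suc (countSame (A′ ++ (true , 0) ∷ B) false 0) ∷ graft M (A′ ++ (true , 0) ∷ B) N
    ≡⟨ cong₂ (λ c G → suc c ∷ G) (trans (countSame-raise A _ false) (countSame-bottom-steps b false))
             (graft-raise M A ((true , 0) ∷ B) N lenA≤) ⟩
  suc (arches b) ∷ map (M +_) (take (length A) N) ++ suc (countSame B true 0) ∷ graft M B (drop (length A) N)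
    ≡⟨ cong (λ n → suc (arches b) ∷ map (M +_) (take n N) ++ suc (countSame B true 0) ∷ graft M B (drop n N)) (length-steps a) ⟩
  suc (arches b) ∷ map (M +_) (take (2 * size a) N) ++ suc (countSame B true 0) ∷ graft M B (drop (2 * size a) N)
    ≡⟨ cong₂ (λ c G → suc (arches b) ∷ map (M +_) (take (2 * size a) N) ++ suc c ∷ G)
             (countSame-bottom-steps b true) (graft≡assemble M b (drop (2 * size a) N) lenDrop) ⟩
  assemble M 0 (archSizes (↑ a ↓ b)) N
    ∎
  where
  open ≡-Reasoning
  A = steps (word a)
  A′ = map (raise 1) A
  B = steps (word b)
  lenA≤ : length A ≤ length N
  lenA≤ = ≤-trans (≤-reflexive (length-steps a)) (≤-trans (*-monoʳ-≤ 2 (m≤m+n (size a) _)) (≤-reflexive (sym len)))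
  lenDrop : length (drop (2 * size a) N) ≡ 2 * sum (archSizes b)
  lenDrop = proj₂ (length-take-drop-double (size a) _ N len)

length-labels : ∀ all s → length (labels all s) ≡ length s
length-labels all [] = refl
length-labels all (_ ∷ s) = cong suc (length-labels all s)

length-dyckNest : ∀ f → length (dyckNest f) ≡ 2 * size f
length-dyckNest f = trans (length-labels (steps (word f)) (steps (word f))) (length-steps f)

length-dyckNest-interior : ∀ f → length (dyckNest (interior f)) ≡ 2 * sum (archSizes f)
length-dyckNest-interior f = trans (length-dyckNest (interior f)) (cong (2 *_) (sym (sum-archSizes f)))

dyckNest≡assemble : ∀ f → dyckNest f ≡ assemble (arches f) 0 (archSizes f) (dyckNest (interior f))
dyckNest≡assemble f = trans (dyckNest≡graft f) (graft≡assemble (arches f) f (dyckNest (interior f)) (length-dyckNest-interior f))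

labels-positive : ∀ all s → All (0 <_) (labels all s)
labels-positive all [] = []
labels-positive all (_ ∷ s) = s≤s z≤n ∷ labels-positive all s

dyckNest-positive : ∀ f → All (0 <_) (dyckNest f)
dyckNest-positive f = labels-positive (steps (word f)) (steps (word f))


-- Positions of a value

halfGap : List ℕ → ℕ
halfGap (p ∷ r ∷ _) = ⌊ r ∸ p /2⌋
halfGap _ = 0

σ≡halfGap : ∀ j H → σ j H ≡ halfGap (positions j H)
σ≡halfGap j H with positions j H
... | [] = refl
... | _ ∷ [] = refl
... | _ ∷ _ ∷ _ = refl

positionsFrom-+ : ∀ c i j H → positionsFrom (c + i) j H ≡ map (c +_) (positionsFrom i j H)
positionsFrom-+ c i j [] = refl
positionsFrom-+ c i j (x ∷ H) rewrite sym (+-suc c i) with x ≡ᵇ j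
... | true = cong (c + i ∷_) (positionsFrom-+ c (suc i) j H)
... | false = positionsFrom-+ c (suc i) j H

halfGap-map-+ : ∀ c P → halfGap (map (c +_) P) ≡ halfGap P
halfGap-map-+ c [] = refl
halfGap-map-+ c (p ∷ []) = refl
halfGap-map-+ c (p ∷ r ∷ P) = cong ⌊_/2⌋ ([m+n]∸[m+o]≡n∸o c r p)

halfGap-positionsFrom : ∀ i i′ j H → halfGap (positionsFrom i j H) ≡ halfGap (positionsFrom i′ j H)
halfGap-positionsFrom i i′ j H = trans (fromZero i) (sym (fromZero i′))
  where
  fromZero : ∀ c → halfGap (positionsFrom c j H) ≡ halfGap (positions j H)
  fromZero c = begin
    halfGap (positionsFrom c j H)                 ≡⟨ cong (λ n → halfGap (positionsFrom n j H)) (+-identityʳ c) ⟨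
    halfGap (positionsFrom (c + 0) j H)           ≡⟨ cong halfGap (positionsFrom-+ c 0 j H) ⟩
    halfGap (map (c +_) (positions j H))          ≡⟨ halfGap-map-+ c (positions j H) ⟩
    halfGap (positions j H)                       ∎
    where open ≡-Reasoning

positionsFrom-++ : ∀ i j xs ys → positionsFrom i j (xs ++ ys) ≡ positionsFrom i j xs ++ positionsFrom (i + length xs) j ys
positionsFrom-++ i j [] ys = cong (λ n → positionsFrom n j ys) (sym (+-identityʳ i))
positionsFrom-++ i j (x ∷ xs) ys rewrite +-suc i (length xs) with x ≡ᵇ j
... | true = cong (i ∷_) (positionsFrom-++ (suc i) j xs ys)
... | false = positionsFrom-++ (suc i) j xs ys

positionsFrom-∷-≢ : ∀ i j x xs → x ≢ j → positionsFrom i j (x ∷ xs) ≡ positionsFrom (suc i) j xs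
positionsFrom-∷-≢ i j x xs x≢j rewrite ≢⇒≡ᵇ≡false x≢j = refl

positionsFrom-∉ : ∀ i j xs → j ∉ xs → positionsFrom i j xs ≡ []
positionsFrom-∉ i j [] _ = refl
positionsFrom-∉ i j (x ∷ xs) j∉ =
  trans (positionsFrom-∷-≢ i j x xs (λ x≡j → j∉ (here (sym x≡j)))) (positionsFrom-∉ (suc i) j xs (j∉ ∘ there))

positionsFrom-++-∉ˡ : ∀ i j xs ys → j ∉ xs → positionsFrom i j (xs ++ ys) ≡ positionsFrom (i + length xs) j ys
positionsFrom-++-∉ˡ i j xs ys j∉ = trans (positionsFrom-++ i j xs ys) (cong (_++ positionsFrom (i + length xs) j ys) (positionsFrom-∉ i j xs j∉))

positionsFrom-++-∉ʳ : ∀ i j xs ys → j ∉ ys → positionsFrom i j (xs ++ ys) ≡ positionsFrom i j xs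
positionsFrom-++-∉ʳ i j xs ys j∉ =
  trans (positionsFrom-++ i j xs ys) (trans (cong (_ ++_) (positionsFrom-∉ _ j ys j∉)) (++-identityʳ _))

positionsFrom-map-+ : ∀ i M j xs → positionsFrom i (M + j) (map (M +_) xs) ≡ positionsFrom i j xs
positionsFrom-map-+ i M j [] = refl
positionsFrom-map-+ i M j (x ∷ xs) rewrite +-cancelˡ-≡ᵇ M x j with x ≡ᵇ j
... | true = cong (i ∷_) (positionsFrom-map-+ (suc i) M j xs)
... | false = positionsFrom-map-+ (suc i) M j xs


-- Values labelling arches

archSize : List ℕ → ℕ → ℕ
archSize [] j = 0
archSize (s ∷ ss) j = if suc (length ss) ≡ᵇ j then s else archSize ss j

∉-map-+ : ∀ M j xs → All (0 <_) xs → j ≤ M → j ∉ map (M +_) xs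
∉-map-+ M j xs pos j≤M j∈ with x , x∈ , refl ← ∈-map⁻ (M +_) j∈ = <⇒≱ (m<m+n M (All.lookup pos x∈)) j≤M

halfGap-assemble-arch : ∀ M ss N i j → j ≤ M → All (0 <_) N → length N ≡ 2 * sum ss →
  halfGap (positionsFrom i j (assemble M 0 ss N)) ≡ archSize ss j
halfGap-assemble-arch M [] N i j _ _ _ = refl
halfGap-assemble-arch M (s ∷ ss) N i j j≤M pos len
  rewrite positionsFrom-++-∉ˡ (suc i) j (map (M +_) (take (2 * s) N)) (suc (length ss) ∷ assemble M 0 ss (drop (2 * s) N))
            (∉-map-+ M j _ (All.take⁺ (2 * s) pos) j≤M)
        | length-map (M +_) (take (2 * s) N)
        | proj₁ (length-take-drop-double s (sum ss) N len)
  with suc (length ss) ≡ᵇ j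
... | true = ⌊[1+i+2n]∸i/2⌋≡n i s
... | false = halfGap-assemble-arch M ss (drop (2 * s) N) _ j j≤M (All.drop⁺ (2 * s) pos) (proj₂ (length-take-drop-double s (sum ss) N len))


-- Separation of the arches

archLabel-bounds : ∀ l n → l < suc (l + n) × suc (l + n) ≤ l + suc n
archLabel-bounds l n = s≤s (m≤m+n l n) , ≤-reflexive (sym (+-suc l n))

∈-assemble : ∀ M l ss N {v} → v ∈ assemble M l ss N →
  (l < v × v ≤ l + length ss) ⊎ ∃ λ x → x ∈ take (2 * sum ss) N × v ≡ M + x
∈-assemble M l (s ∷ ss) N (here refl) = inj₁ (archLabel-bounds l (length ss))
∈-assemble M l (s ∷ ss) N (there v∈) with ∈-++⁻ (map (M +_) (take (2 * s) N)) v∈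
... | inj₁ v∈map with x , x∈ , refl ← ∈-map⁻ (M +_) v∈map =
  inj₂ (x , Sublist.lookup (take⁺ (*-monoʳ-≤ 2 (m≤m+n s (sum ss)))) x∈ , refl)
... | inj₂ (here refl) = inj₁ (archLabel-bounds l (length ss))
... | inj₂ (there v∈rest) with ∈-assemble M l ss (drop (2 * s) N) v∈rest
...   | inj₁ (l<v , v≤) = inj₁ (l<v , ≤-trans v≤ (+-monoʳ-≤ l (n≤1+n _)))
...   | inj₂ (x , x∈ , refl) = inj₂ (x , subst (λ n → x ∈ take n N) (sym (*-distribˡ-+ 2 s (sum ss))) x∈take , refl)
  where
  x∈take : x ∈ take (2 * s + 2 * sum ss) N
  x∈take = ∈-take-drop (2 * sum ss) (2 * s) N x∈

offset-length-++ : ∀ l (xs ys : List ℕ) → l + length (xs ++ ys) ≡ l + length ys + length xs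
offset-length-++ l xs ys = trans (cong (l +_) (trans (length-++ xs) (+-comm (length xs) _))) (sym (+-assoc l _ _))

assemble-++ : ∀ M l ss₁ ss₂ N →
  assemble M l (ss₁ ++ ss₂) N ≡ assemble M (l + length ss₂) ss₁ N ++ assemble M l ss₂ (drop (2 * sum ss₁) N)
assemble-++ M l [] ss₂ N = refl
assemble-++ M l (s ∷ ss₁) ss₂ N
  rewrite offset-length-++ l ss₁ ss₂
        | assemble-++ M l ss₁ ss₂ (drop (2 * s) N)
        | drop-drop (2 * s) (2 * sum ss₁) N
        | sym (*-distribˡ-+ 2 s (sum ss₁))
        = cong (L ∷_) (sym (++-assoc (map (M +_) (take (2 * s) N)) (L ∷ assemble M (l + length ss₂) ss₁ (drop (2 * s) N)) _))
  where L = suc (l + length ss₂ + length ss₁)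

length-assemble : ∀ M l ss N → 2 * sum ss ≤ length N → length (assemble M l ss N) ≡ 2 * sum (map suc ss)
length-assemble M l [] N _ = refl
length-assemble M l (s ∷ ss) N le = begin
  suc (length (map (M +_) (take (2 * s) N) ++ L ∷ rest))   ≡⟨ cong suc (length-++ (map (M +_) (take (2 * s) N))) ⟩
  suc (length (map (M +_) (take (2 * s) N)) + suc (length rest))
    ≡⟨ cong₂ (λ m n → suc (m + suc n)) (trans (length-map (M +_) (take (2 * s) N)) lenTake)
             (length-assemble M l ss (drop (2 * s) N) lenDrop) ⟩
  suc (2 * s + suc (2 * sum (map suc ss)))                  ≡⟨ double-arch s _ ⟩
  2 * sum (map suc (s ∷ ss))                                ∎
  where
  open ≡-Reasoning
  L = suc (l + length ss)
  rest = assemble M l ss (drop (2 * s) N)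
  le′ : 2 * s + 2 * sum ss ≤ length N
  le′ = subst (_≤ length N) (*-distribˡ-+ 2 s (sum ss)) le
  lenTake : length (take (2 * s) N) ≡ 2 * s
  lenTake = proj₁ (length-take-drop-≤ (2 * s) _ N le′)
  lenDrop : 2 * sum ss ≤ length (drop (2 * s) N)
  lenDrop = proj₂ (length-take-drop-≤ (2 * s) _ N le′)

dyckNest-⊕ : ∀ g₁ g₂ → dyckNest (g₁ ⊕ g₂) ≡
  assemble (arches (g₁ ⊕ g₂)) (arches g₂) (archSizes g₁) (dyckNest (interior g₁ ⊕ interior g₂)) ++
  assemble (arches (g₁ ⊕ g₂)) 0 (archSizes g₂) (drop (2 * size (interior g₁)) (dyckNest (interior g₁ ⊕ interior g₂)))
dyckNest-⊕ g₁ g₂ = begin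
  dyckNest (g₁ ⊕ g₂)                                    ≡⟨ dyckNest≡assemble (g₁ ⊕ g₂) ⟩
  assemble M 0 (archSizes (g₁ ⊕ g₂)) (dyckNest (interior (g₁ ⊕ g₂)))
    ≡⟨ cong₂ (assemble M 0) (archSizes-⊕ g₁ g₂) (cong dyckNest (interior-⊕ g₁ g₂)) ⟩
  assemble M 0 (archSizes g₁ ++ archSizes g₂) N          ≡⟨ assemble-++ M 0 (archSizes g₁) (archSizes g₂) N ⟩
  assemble M (arches g₂) (archSizes g₁) N ++ assemble M 0 (archSizes g₂) (drop (2 * sum (archSizes g₁)) N)
    ≡⟨ cong (λ n → assemble M (arches g₂) (archSizes g₁) N ++ assemble M 0 (archSizes g₂) (drop (2 * n) N)) (sum-archSizes g₁) ⟩
  assemble M (arches g₂) (archSizes g₁) N ++ assemble M 0 (archSizes g₂) (drop (2 * size (interior g₁)) N)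
    ∎
  where
  open ≡-Reasoning
  M = arches (g₁ ⊕ g₂)
  N = dyckNest (interior g₁ ⊕ interior g₂)

split-dyckNest-⊕ : ∀ g₁ g₂ →
  let M = arches (g₁ ⊕ g₂)
      N = dyckNest (interior g₁ ⊕ interior g₂)
      H = dyckNest (g₁ ⊕ g₂)
  in take (2 * size g₁) H ≡ assemble M (arches g₂) (archSizes g₁) N
   × drop (2 * size g₁) H ≡ assemble M 0 (archSizes g₂) (drop (2 * size (interior g₁)) N)
split-dyckNest-⊕ g₁ g₂ = take-drop-≡++ (dyckNest-⊕ g₁ g₂)
  (trans (length-assemble (arches (g₁ ⊕ g₂)) (arches g₂) (archSizes g₁) N sum≤) (cong (2 *_) (sym (size≡sum-suc-archSizes g₁))))
  where
  N = dyckNest (interior g₁ ⊕ interior g₂)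
  sum≤ : 2 * sum (archSizes g₁) ≤ length N
  sum≤ rewrite length-dyckNest (interior g₁ ⊕ interior g₂) | size-⊕ (interior g₁) (interior g₂) | sum-archSizes g₁ =
    *-monoʳ-≤ 2 (m≤m+n (size (interior g₁)) (size (interior g₂)))

separated-⊕ : ∀ n g₁ g₂ → size (g₁ ⊕ g₂) ≤ n → ∀ {v} →
  v ∈ take (2 * size g₁) (dyckNest (g₁ ⊕ g₂)) → v ∉ drop (2 * size g₁) (dyckNest (g₁ ⊕ g₂))
separated-⊕ n ε g₂ _ ()
separated-⊕ zero (↑ a ↓ b) g₂ ()
separated-⊕ (suc n) g₁@(↑ a ↓ b) g₂ bound {v} v∈take v∈drop =
  disjoint (∈-assemble M l ss₁ N (subst (v ∈_) (proj₁ (split-dyckNest-⊕ g₁ g₂)) v∈take))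
           (∈-assemble M 0 ss₂ N₂ (subst (v ∈_) (proj₂ (split-dyckNest-⊕ g₁ g₂)) v∈drop))
  where
  l = arches g₂
  M = arches (g₁ ⊕ g₂)
  ss₁ = archSizes g₁
  ss₂ = archSizes g₂
  N = dyckNest (interior g₁ ⊕ interior g₂)
  N₂ = drop (2 * size (interior g₁)) N
  positive : ∀ {x} → x ∈ N → 0 < x
  positive = All.lookup (dyckNest-positive _)
  l≤M : l ≤ M
  l≤M = ≤-trans (m≤n+m l (arches g₁)) (≤-reflexive (sym (arches-⊕ g₁ g₂)))
  bound′ : size (interior g₁ ⊕ interior g₂) ≤ n
  bound′ = s≤s⁻¹ (≤-trans (s≤s (≤-reflexive (cong size (sym (interior-⊕ g₁ g₂))))) (≤-trans (size-interior< a (b ⊕ g₂)) bound))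
  disjoint : (l < v × v ≤ l + length ss₁) ⊎ (∃ λ x → x ∈ take (2 * sum ss₁) N × v ≡ M + x) →
             (0 < v × v ≤ length ss₂) ⊎ (∃ λ x → x ∈ take (2 * sum ss₂) N₂ × v ≡ M + x) → ⊥
  disjoint (inj₁ (l<v , _)) (inj₁ (_ , v≤l)) = <⇒≱ l<v v≤l
  disjoint (inj₁ (_ , v≤)) (inj₂ (x , x∈ , refl)) =
    <⇒≱ (m<m+n M (positive (Sublist.lookup (drop-⊆ (2 * size (interior g₁)) N) (Sublist.lookup (take-⊆ (2 * sum ss₂) N₂) x∈))))
        (≤-trans v≤ (≤-reflexive (trans (+-comm l _) (sym (arches-⊕ g₁ g₂)))))
  disjoint (inj₂ (x , x∈ , refl)) (inj₁ (_ , v≤l)) =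
    <⇒≱ (m<m+n M (positive (Sublist.lookup (take-⊆ (2 * sum ss₁) N) x∈))) (≤-trans v≤l l≤M)
  disjoint (inj₂ (x , x∈ , refl)) (inj₂ (x′ , x′∈ , e)) =
    separated-⊕ n (interior g₁) (interior g₂) bound′
      (subst (λ m → x ∈ take (2 * m) N) (sum-archSizes g₁) x∈)
      (subst (_∈ N₂) (sym (+-cancelˡ-≡ M x x′ e)) (Sublist.lookup (take-⊆ (2 * sum ss₂) N₂) x′∈))

Separated : List ℕ → List ℕ → Set
Separated [] N = ⊤
Separated (s ∷ ss) N = (∀ {v} → v ∈ take (2 * s) N → v ∉ drop (2 * s) N) × Separated ss (drop (2 * s) N)

separated-archSizes : ∀ b pre → Separated (archSizes b) (drop (2 * size pre) (dyckNest (pre ⊕ interior b)))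
separated-archSizes ε pre = tt
separated-archSizes (↑ a ↓ b) pre = first , subst (Separated (archSizes b)) drops (separated-archSizes b (pre ⊕ a))
  where
  H = dyckNest (pre ⊕ (a ⊕ interior b))
  H′≡H : dyckNest ((pre ⊕ a) ⊕ interior b) ≡ H
  H′≡H = cong dyckNest (⊕-assoc pre a (interior b))
  2size : 2 * size (pre ⊕ a) ≡ 2 * size pre + 2 * size a
  2size = trans (cong (2 *_) (size-⊕ pre a)) (*-distribˡ-+ 2 (size pre) (size a))
  drops : drop (2 * size (pre ⊕ a)) (dyckNest ((pre ⊕ a) ⊕ interior b)) ≡ drop (2 * size a) (drop (2 * size pre) H)
  drops = trans (cong₂ drop 2size H′≡H) (sym (drop-drop (2 * size pre) (2 * size a) H))
  first : ∀ {v} → v ∈ take (2 * size a) (drop (2 * size pre) H) → v ∉ drop (2 * size a) (drop (2 * size pre) H)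
  first {v} v∈ v∈′ = separated-⊕ _ (pre ⊕ a) (interior b) ≤-refl
    (subst₂ (λ m h → v ∈ take m h) (sym 2size) (sym H′≡H) (∈-take-drop (2 * size a) (2 * size pre) H v∈))
    (subst (v ∈_) (sym drops) v∈′)


-- Values labelling the interior

archLabel≢lifted : ∀ M j n → suc n ≤ M → 0 < j → suc n ≢ M + j
archLabel≢lifted M j n n<M j>0 e = <⇒≱ (m<m+n M j>0) (≤-trans (≤-reflexive (sym e)) n<M)

lifted∉assemble : ∀ M ss N j → length ss ≤ M → 0 < j → j ∉ N → M + j ∉ assemble M 0 ss N
lifted∉assemble M ss N j ss≤M j>0 j∉ M+j∈ with ∈-assemble M 0 ss N M+j∈
... | inj₁ (_ , M+j≤) = <⇒≱ (m<m+n M j>0) (≤-trans M+j≤ ss≤M)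
... | inj₂ (x , x∈ , e) = j∉ (subst (_∈ N) (sym (+-cancelˡ-≡ M j x e)) (Sublist.lookup (take-⊆ (2 * sum ss) N) x∈))

halfGap-lifted-block : ∀ M i i′ j N₁ N₂ R → j ∉ N₂ → M + j ∉ R →
  halfGap (positionsFrom i (M + j) (map (M +_) N₁ ++ R)) ≡ halfGap (positionsFrom i′ j (N₁ ++ N₂))
halfGap-lifted-block M i i′ j N₁ N₂ R j∉N₂ M+j∉R = begin
  halfGap (positionsFrom i (M + j) (map (M +_) N₁ ++ R)) ≡⟨ cong halfGap (positionsFrom-++-∉ʳ i (M + j) (map (M +_) N₁) R M+j∉R) ⟩
  halfGap (positionsFrom i (M + j) (map (M +_) N₁))      ≡⟨ cong halfGap (positionsFrom-map-+ i M j N₁) ⟩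
  halfGap (positionsFrom i j N₁)                         ≡⟨ halfGap-positionsFrom i i′ j N₁ ⟩
  halfGap (positionsFrom i′ j N₁)                        ≡⟨ cong halfGap (positionsFrom-++-∉ʳ i′ j N₁ N₂ j∉N₂) ⟨
  halfGap (positionsFrom i′ j (N₁ ++ N₂))                ∎
  where open ≡-Reasoning

-- Separation keeps both occurrences of j inside one block of N, so no arch label inserted
-- by assemble falls between them.
halfGap-assemble-lifted : ∀ M ss N i i′ j → length ss ≤ M → 0 < j → length N ≡ 2 * sum ss → Separated ss N →
  halfGap (positionsFrom i (M + j) (assemble M 0 ss N)) ≡ halfGap (positionsFrom i′ j N)
halfGap-assemble-lifted M [] [] i i′ j _ _ _ _ = refl
halfGap-assemble-lifted M (s ∷ ss) N i i′ j ss<M j>0 len (block , separated) = begin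
  halfGap (positionsFrom i (M + j) (L ∷ map (M +_) N₁ ++ L ∷ rest))   ≡⟨ cong halfGap (positionsFrom-∷-≢ i (M + j) L (map (M +_) N₁ ++ L ∷ rest) L≢) ⟩
  halfGap (positionsFrom (suc i) (M + j) (map (M +_) N₁ ++ L ∷ rest)) ≡⟨ byBlock (j ∈? N₁) ⟩
  halfGap (positionsFrom i′ j (N₁ ++ N₂))                            ≡⟨ cong (λ H → halfGap (positionsFrom i′ j H)) (take++drop≡id (2 * s) N) ⟩
  halfGap (positionsFrom i′ j N)                                     ∎
  where
  open ≡-Reasoning
  N₁ = take (2 * s) N
  N₂ = drop (2 * s) N
  L = suc (length ss)
  rest = assemble M 0 ss N₂
  ss≤M : length ss ≤ M
  ss≤M = ≤-trans (n≤1+n _) ss<M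
  L≢ : L ≢ M + j
  L≢ = archLabel≢lifted M j (length ss) ss<M j>0
  byBlock : Dec (j ∈ N₁) →
    halfGap (positionsFrom (suc i) (M + j) (map (M +_) N₁ ++ L ∷ rest)) ≡ halfGap (positionsFrom i′ j (N₁ ++ N₂))
  byBlock (yes j∈) = halfGap-lifted-block M (suc i) i′ j N₁ N₂ (L ∷ rest) (block j∈) L∷rest∌
    where
    L∷rest∌ : M + j ∉ L ∷ rest
    L∷rest∌ (here e) = L≢ (sym e)
    L∷rest∌ (there M+j∈) = lifted∉assemble M ss N₂ j ss≤M j>0 (block j∈) M+j∈
  byBlock (no j∉) = begin
    halfGap (positionsFrom (suc i) (M + j) (map (M +_) N₁ ++ L ∷ rest))
      ≡⟨ cong halfGap (positionsFrom-++-∉ˡ (suc i) (M + j) (map (M +_) N₁) (L ∷ rest) (j∉ ∘ lifted∈⁻)) ⟩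
    halfGap (positionsFrom (suc i + length (map (M +_) N₁)) (M + j) (L ∷ rest))
      ≡⟨ cong halfGap (positionsFrom-∷-≢ (suc i + length (map (M +_) N₁)) (M + j) L rest L≢) ⟩
    halfGap (positionsFrom (suc (suc i + length (map (M +_) N₁))) (M + j) rest)
      ≡⟨ halfGap-assemble-lifted M ss N₂ _ _ j ss≤M j>0 (proj₂ (length-take-drop-double s (sum ss) N len)) separated ⟩
    halfGap (positionsFrom (i′ + length N₁) j N₂)
      ≡⟨ cong halfGap (positionsFrom-++-∉ˡ i′ j N₁ N₂ j∉) ⟨
    halfGap (positionsFrom i′ j (N₁ ++ N₂))                            ∎
    where
    lifted∈⁻ : M + j ∈ map (M +_) N₁ → j ∈ N₁
    lifted∈⁻ M+j∈ with x , x∈ , e ← ∈-map⁻ (M +_) M+j∈ = subst (_∈ N₁) (sym (+-cancelˡ-≡ M j x e)) x∈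


-- Recovering the nest from the clone

archSize-∷ʳ-one : ∀ xs x → archSize (xs ∷ʳ x) 1 ≡ x
archSize-∷ʳ-one [] x = refl
archSize-∷ʳ-one (y ∷ ys) x rewrite length-∷ʳ ys x = archSize-∷ʳ-one ys x

archSize-∷ʳ-suc : ∀ xs x j → 0 < j → archSize (xs ∷ʳ x) (suc j) ≡ archSize xs j
archSize-∷ʳ-suc [] x (suc j) _ = refl
archSize-∷ʳ-suc (y ∷ ys) x j j>0 rewrite length-∷ʳ ys x with suc (length ys) ≡ᵇ j
... | true = refl
... | false = archSize-∷ʳ-suc ys x j j>0

-- Arch sizes are recovered from the labels 1, 2, … (the rightmost arch first); the size
-- of the arch with the largest label, which may not be queried, is fixed by the total.
archSizes-determined-rev : ∀ rs rs′ → sum (map suc rs) ≡ sum (map suc rs′) →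
  (∀ j → 0 < j → j < sum (map suc rs) → j ≤ length rs → j ≤ length rs′ →
     archSize (reverse rs) j ≡ archSize (reverse rs′) j) →
  rs ≡ rs′
archSizes-determined-rev [] [] _ _ = refl
archSizes-determined-rev (r ∷ rs) (r′ ∷ rs′) total agree = cong₂ _∷_ r≡r′ (archSizes-determined-rev rs rs′ total′ agree′)
  where
  open ≡-Reasoning
  last : ∀ x xs → archSize (reverse (x ∷ xs)) 1 ≡ x
  last x xs = trans (cong (λ ys → archSize ys 1) (unfold-reverse x xs)) (archSize-∷ʳ-one (reverse xs) x)
  init : ∀ x xs j → 0 < j → archSize (reverse (x ∷ xs)) (suc j) ≡ archSize (reverse xs) j
  init x xs j j>0 = trans (cong (λ ys → archSize ys (suc j)) (unfold-reverse x xs)) (archSize-∷ʳ-suc (reverse xs) x j j>0)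
  r≡r′ : r ≡ r′
  r≡r′ with 1 <? sum (map suc (r ∷ rs))
  ... | yes 1<k = trans (sym (last r rs)) (trans (agree 1 (s≤s z≤n) 1<k (s≤s z≤n) (s≤s z≤n)) (last r′ rs′))
  ... | no 1≮k = trans (m+n≡0⇒m≡0 r (n≤0⇒n≡0 (s≤s⁻¹ (≮⇒≥ 1≮k))))
                       (sym (m+n≡0⇒m≡0 r′ (n≤0⇒n≡0 (s≤s⁻¹ (≮⇒≥ (subst (λ k → ¬ 1 < k) total 1≮k))))))
  total′ : sum (map suc rs) ≡ sum (map suc rs′)
  total′ = +-cancelˡ-≡ r _ _ (trans (suc-injective total) (cong (_+ sum (map suc rs′)) (sym r≡r′)))
  agree′ : ∀ j → 0 < j → j < sum (map suc rs) → j ≤ length rs → j ≤ length rs′ →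
    archSize (reverse rs) j ≡ archSize (reverse rs′) j
  agree′ j j>0 j<k j≤ j≤′ = begin
    archSize (reverse rs) j               ≡⟨ init r rs j j>0 ⟨
    archSize (reverse (r ∷ rs)) (suc j)   ≡⟨ agree (suc j) (s≤s z≤n) (s≤s (≤-trans j<k (m≤n+m _ r))) (s≤s j≤) (s≤s j≤′) ⟩
    archSize (reverse (r′ ∷ rs′)) (suc j) ≡⟨ init r′ rs′ j j>0 ⟩
    archSize (reverse rs′) j              ∎

archSizes-determined : ∀ ss ss′ → sum (map suc ss) ≡ sum (map suc ss′) →
  (∀ j → 0 < j → j < sum (map suc ss) → j ≤ length ss → j ≤ length ss′ → archSize ss j ≡ archSize ss′ j) →
  ss ≡ ss′
archSizes-determined ss ss′ total agree = reverse-injective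
  (archSizes-determined-rev (reverse ss) (reverse ss′)
    (trans (sum-suc-reverse ss) (trans total (sym (sum-suc-reverse ss′))))
    λ j j>0 j<k j≤ j≤′ → subst₂ (λ xs ys → archSize xs j ≡ archSize ys j) (sym (reverse-involutive ss)) (sym (reverse-involutive ss′))
      (agree j j>0 (subst (j <_) (sum-suc-reverse ss) j<k) (subst (j ≤_) (length-reverse ss) j≤) (subst (j ≤_) (length-reverse ss′) j≤′)))
  where
  sum-suc-reverse : ∀ xs → sum (map suc (reverse xs)) ≡ sum (map suc xs)
  sum-suc-reverse xs = trans (cong sum (reverse-map suc xs)) (sum-↭ (↭-reverse (map suc xs)))

σ-arch : ∀ f j → j ≤ arches f → σ j (dyckNest f) ≡ archSize (archSizes f) j
σ-arch f j j≤M = begin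
  σ j (dyckNest f)                                                        ≡⟨ σ≡halfGap j (dyckNest f) ⟩
  halfGap (positions j (dyckNest f))                                      ≡⟨ cong (λ H → halfGap (positions j H)) (dyckNest≡assemble f) ⟩
  halfGap (positions j (assemble (arches f) 0 (archSizes f) (dyckNest (interior f))))
    ≡⟨ halfGap-assemble-arch (arches f) (archSizes f) (dyckNest (interior f)) 0 j j≤M (dyckNest-positive (interior f)) (length-dyckNest-interior f) ⟩
  archSize (archSizes f) j                                                ∎
  where open ≡-Reasoning

σ-lifted : ∀ f j → 0 < j → σ (arches f + j) (dyckNest f) ≡ σ j (dyckNest (interior f))
σ-lifted f j j>0 = begin
  σ (arches f + j) (dyckNest f)                                            ≡⟨ σ≡halfGap (arches f + j) (dyckNest f) ⟩
  halfGap (positions (arches f + j) (dyckNest f))                          ≡⟨ cong (λ H → halfGap (positions (arches f + j) H)) (dyckNest≡assemble f) ⟩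
  halfGap (positions (arches f + j) (assemble (arches f) 0 (archSizes f) (dyckNest (interior f))))
    ≡⟨ halfGap-assemble-lifted (arches f) (archSizes f) (dyckNest (interior f)) 0 0 j ≤-refl j>0
         (length-dyckNest-interior f) (separated-archSizes f ε) ⟩
  halfGap (positions j (dyckNest (interior f)))                            ≡⟨ σ≡halfGap j (dyckNest (interior f)) ⟨
  σ j (dyckNest (interior f))                                              ∎
  where open ≡-Reasoning

dyckNest-injective : ∀ n f f′ → size f ≤ n → size f ≡ size f′ →
  (∀ j → 0 < j → j < size f → σ j (dyckNest f) ≡ σ j (dyckNest f′)) → dyckNest f ≡ dyckNest f′
dyckNest-injective n ε ε _ _ _ = refl
dyckNest-injective zero (↑ a ↓ b) f′ () _ _
dyckNest-injective (suc n) f@(↑ a ↓ b) f′ size≤ size≡ agree = begin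
  dyckNest f                                                             ≡⟨ dyckNest≡assemble f ⟩
  assemble (arches f) 0 (archSizes f) (dyckNest (interior f))            ≡⟨ cong₂ (λ ss N → assemble (length ss) 0 ss N) ss≡ss′ interiors ⟩
  assemble (arches f′) 0 (archSizes f′) (dyckNest (interior f′))         ≡⟨ dyckNest≡assemble f′ ⟨
  dyckNest f′                                                            ∎
  where
  open ≡-Reasoning
  ss≡ss′ : archSizes f ≡ archSizes f′
  ss≡ss′ = archSizes-determined (archSizes f) (archSizes f′)
    (trans (sym (size≡sum-suc-archSizes f)) (trans size≡ (size≡sum-suc-archSizes f′)))
    λ j j>0 j<k j≤ j≤′ → trans (sym (σ-arch f j j≤))
      (trans (agree j j>0 (subst (j <_) (sym (size≡sum-suc-archSizes f)) j<k)) (σ-arch f′ j j≤′))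
  size-split : size f ≡ arches f + size (interior f)
  size-split = size≡arches+size-interior f
  interiors : dyckNest (interior f) ≡ dyckNest (interior f′)
  interiors = dyckNest-injective n (interior f) (interior f′)
    (s≤s⁻¹ (≤-trans (size-interior< a b) size≤))
    (trans (sym (sum-archSizes f)) (trans (cong sum ss≡ss′) (sum-archSizes f′)))
    λ j j>0 j<k → begin
      σ j (dyckNest (interior f))           ≡⟨ σ-lifted f j j>0 ⟨
      σ (arches f + j) (dyckNest f)         ≡⟨ agree (arches f + j) (<-≤-trans j>0 (m≤n+m j _)) (subst (arches f + j <_) (sym size-split) (+-monoʳ-< (arches f) j<k)) ⟩
      σ (arches f + j) (dyckNest f′)        ≡⟨ cong (λ M → σ (M + j) (dyckNest f′)) (cong length ss≡ss′) ⟩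
      σ (arches f′ + j) (dyckNest f′)       ≡⟨ σ-lifted f′ j j>0 ⟩
      σ j (dyckNest (interior f′))          ∎

clone-≡⇒σ-≡ : ∀ k H H′ → clone k H ≡ clone k H′ → ∀ j → 0 < j → j < k → σ j H ≡ σ j H′
clone-≡⇒σ-≡ k H H′ clones (suc i) _ i+1<k =
  map-≡⇒≡ (λ i → σ (suc i) H) (λ i → σ (suc i) H′) (downFrom (k ∸ 1)) clones (∈-downFrom⁺ (∸-monoˡ-≤ 1 i+1<k))

theorem40 : (k : ℕ) → 1 ≤ k → (w w′ : List Bool) →
    IsDyckWord k w → IsDyckWord k w′ →
    clone k (nest w) ≡ clone k (nest w′) → nest w ≡ nest w′
theorem40 k _ w w′ dyck dyck′ clones with dyckWord⇒word k w dyck | dyckWord⇒word k w′ dyck′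
... | f , refl , refl | f′ , refl , size′ =
  dyckNest-injective (size f) f f′ ≤-refl (sym size′) (clone-≡⇒σ-≡ (size f) (dyckNest f) (dyckNest f′) clones)
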